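{- Let $\mu:G\times H\to K$ be a graph homomorphism, let $g_0g_1$ be an oriented edge of $G$ and $h_0h_1$ an oriented edge of $H$. Let $C$ be a closed reduced walk in $G$ from $g_0$ and $D$ a closed reduced walk in $H$ from $h_0$. Then $[\mu(C\times h_0h_1)]$ and $[\mu(g_0g_1\times D)]$ commute in $\pi_{/\sim}(K)$.
   Context: All graphs are finite, simple, loopless. $G\times H$ is the tensor product (vertices $V(G)\times V(H)$, $(g,h)(g',h')$ an edge iff $gg'\in E(G)$ and $hh'\in E(H)$). A walk is a sequence of oriented edges, each starting where the previous ends; $WW'$ is concatenation, $W^{ -1}$ the reverse, $\overline{W}$ the result of repeatedly deleting consecutive pairs $e,e^{ -1}$; reduced means $W=\overline{W}$. For a closed walk $C$ in $G$ from $g$ and an oriented edge $h_0h_1$ of $H$, $C\times h_0h_1$ is the closed walk in $G\times H$ from $(g,h_0)$ whose projection to $G$ is $CC$ and whose projection to $H$ is $h_0h_1\,h_1h_0$ repeated $|C|$ times; symmetrically $g_0g_1\times D$ for a closed walk $D$ in $H$ has projection $DD$ to $H$ and $g_0g_1\,g_1g_0$ repeated $|D|$ times to $G$. A square is a quadruple $v_1,\dots,v_4$ with $v_1v_2,v_2v_3,v_3v_4,v_4v_1$ edges. $\sim$ is the smallest equivalence relation on walks with $W\sim\overline{W}$ and $W\,v_1v_2\,v_2v_3\,W'\sim W\,v_1v_4\,v_4v_3\,W'$ for all walks $W,W'$ and squares. $\pi_{/\sim}(K)$ is the groupoid of classes $[W]$ with $[W]\cdot[W']=[WW']$. -}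

module Defs where

open import Data.Bool using (Bool; true; false; T; _∧_)
open import Data.Bool.Properties using (∧-comm)
open import Data.Nat using (ℕ; zero; suc; _+_; _*_)
open import Data.Nat.Properties using (+-suc)
open import Data.Fin using (Fin)
open import Data.Fin.Properties using (*↔×)
open import Data.Product using (Σ; _×_; _,_; proj₁; proj₂)
open import Data.Product.Properties using (≡-dec)
open import Data.Product.Function.NonDependent.Propositional using (_×-↔_)
open import Function.Bundles using (_↔_)
open import Function.Properties.Inverse using (↔-trans; ↔-sym)
open import Relation.Binary.Definitions using (DecidableEquality)
open import Relation.Binary.PropositionalEquality using (_≡_; refl; cong; cong₂; trans; sym)
open import Relation.Nullary using (yes; no)

record Graph : Set₁ where
  field
    V      : Set
    size   : ℕ
    finite : V ↔ Fin size
    _≟_    : DecidableEquality V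
    adj    : V → V → Bool
    symm   : ∀ u v → adj u v ≡ adj v u
    loopless : ∀ v → adj v v ≡ false

open Graph public

Edge : (G : Graph) → V G → V G → Set
Edge G u v = T (adj G u v)

_⊗_ : Graph → Graph → Graph
G ⊗ H = record
  { V = V G × V H
  ; size = size G * size H
  ; finite = ↔-trans (finite G ×-↔ finite H) (↔-sym *↔×)
  ; _≟_ = ≡-dec (_≟_ G) (_≟_ H)
  ; adj = λ p q → adj G (proj₁ p) (proj₁ q) ∧ adj H (proj₂ p) (proj₂ q)
  ; symm = λ p q → cong₂ _∧_ (symm G (proj₁ p) (proj₁ q)) (symm H (proj₂ p) (proj₂ q))
  ; loopless = λ p → trans (cong (_∧ adj H (proj₂ p) (proj₂ p)) (loopless G (proj₁ p))) refl
  }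

record Hom (G K : Graph) : Set where
  field
    fun  : V G → V K
    pres : ∀ {u v} → Edge G u v → Edge K (fun u) (fun v)

open Hom public

data Walk (G : Graph) : V G → V G → Set where
  []   : ∀ {u} → Walk G u u
  step : ∀ {u w} (v : V G) → Edge G u v → Walk G v w → Walk G u w

module _ {G : Graph} where

  length : ∀ {u v} → Walk G u v → ℕ
  length []           = 0
  length (step _ _ W) = suc (length W)

  _++_ : ∀ {u v w} → Walk G u v → Walk G v w → Walk G u w
  []           ++ W' = W'
  step v e W   ++ W' = step v e (W ++ W')

  infixr 5 _++_

  edge : ∀ {u v} → Edge G u v → Walk G u v
  edge {v = v} e = step v e []

  flip : ∀ {u v} → Edge G u v → Edge G v u
  flip {u} {v} e rewrite symm G v u = e

  reverse : ∀ {u v} → Walk G u v → Walk G v u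
  reverse []                 = []
  reverse (step v e W) = reverse W ++ edge (flip e)

  -- prepend an edge u v to an already reduced walk, cancelling a pair
  -- e, e⁻¹ if one is created
  consRed : ∀ {u w} (v : V G) → Edge G u v → Walk G v w → Walk G u w
  consRed v e [] = step v e []
  consRed {u} v e (step x e' W) with _≟_ G u x
  ... | yes refl = W
  ... | no _     = step v e (step x e' W)

  -- W̄ : the result of repeatedly deleting consecutive pairs e, e⁻¹
  reduce : ∀ {u v} → Walk G u v → Walk G u v
  reduce []           = []
  reduce (step v e W) = consRed v e (reduce W)

  Reduced : ∀ {u v} → Walk G u v → Set
  Reduced W = reduce W ≡ W

  data _∼_ : ∀ {u v} → Walk G u v → Walk G u v → Set where
    ∼-refl  : ∀ {u v} {W : Walk G u v} → W ∼ W
    ∼-sym   : ∀ {u v} {W W' : Walk G u v} → W ∼ W' → W' ∼ W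
    ∼-trans : ∀ {u v} {W₁ W₂ W₃ : Walk G u v} → W₁ ∼ W₂ → W₂ ∼ W₃ → W₁ ∼ W₃
    ∼-red   : ∀ {u v} (W : Walk G u v) → W ∼ reduce W
    ∼-sq    : ∀ {a b} {v₁ v₂ v₃ v₄ : V G}
              (W : Walk G a v₁) (W' : Walk G v₃ b)
              (e₁₂ : Edge G v₁ v₂) (e₂₃ : Edge G v₂ v₃)
              (e₃₄ : Edge G v₃ v₄) (e₄₁ : Edge G v₄ v₁) →
              (W ++ step v₂ e₁₂ (step v₃ e₂₃ W')) ∼
              (W ++ step v₄ (flip e₄₁) (step v₃ (flip e₃₄) W'))

  infix 4 _∼_

  length-++ : ∀ {u v w} (W : Walk G u v) (W' : Walk G v w) →
              length (W ++ W') ≡ length W + length W'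
  length-++ []           W' = refl
  length-++ (step v e W) W' = cong suc (length-++ W W')

mapWalk : ∀ {G K} (μ : Hom G K) {u v} → Walk G u v → Walk K (fun μ u) (fun μ v)
mapWalk μ []           = []
mapWalk μ (step v e W) = step (fun μ v) (pres μ e) (mapWalk μ W)

bounce : (G : Graph) {h₀ h₁ : V G} → Edge G h₀ h₁ → ℕ → Walk G h₀ h₀
bounce G e zero    = []
bounce G {h₀} {h₁} e (suc n) = step h₁ e (step h₀ (flip {G = G} e) (bounce G e n))

length-bounce : (G : Graph) {h₀ h₁ : V G} (e : Edge G h₀ h₁) (n : ℕ) →
                length (bounce G e n) ≡ n + n
length-bounce G e zero    = refl
length-bounce G e (suc n) = cong suc (trans (cong suc (length-bounce G e n)) (sym (+-suc n n)))

zipWalk : ∀ {G H} {a b : V G} {c d : V H} (P : Walk G a b) (Q : Walk H c d) →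
          length P ≡ length Q → Walk (G ⊗ H) (a , c) (b , d)
zipWalk []            []            _  = []
zipWalk [] (step _ _ _) ()
zipWalk (step _ _ _) [] ()
zipWalk {G} {H} (step v e P) (step w f Q) eq =
  step (v , w) (pair (adj G _ v) (adj H _ w) e f)
       (zipWalk P Q (suc-inj eq))
  where
    pair : ∀ x y → T x → T y → T (x ∧ y)
    pair true true _ _ = _
    suc-inj : ∀ {m n} → suc m ≡ suc n → m ≡ n
    suc-inj refl = refl

walk×edge : (G H : Graph) {g : V G} {h₀ h₁ : V H} →
            Walk G g g → Edge H h₀ h₁ → Walk (G ⊗ H) (g , h₀) (g , h₀)
walk×edge G H C e = zipWalk (C ++ C) (bounce H e (length C))
                 (trans (length-++ C C) (sym (length-bounce H e (length C))))

edge×walk : (G H : Graph) {g₀ g₁ : V G} {h : V H} →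
            Edge G g₀ g₁ → Walk H h h → Walk (G ⊗ H) (g₀ , h) (g₀ , h)
edge×walk G H e D = zipWalk (bounce G e (length D)) (D ++ D)
                 (trans (length-bounce G e (length D)) (sym (length-++ D D)))

module Submission where

-- Write P = C C and Q = D D; the two walks of the
-- statement are  zip(P, bounce on h₀h₁)  and  zip(bounce on g₀g₁, Q).  Read two
-- steps at a time, such walks in G × H are lattice paths in the grid
-- (p₂ᵢ , q₂ⱼ): the first one walks along P at height q₀, the second one
-- along Q at p₀ = p₂ₙ.  The concatenation "along P, then along Q" can be
-- deformed into "along Q, then along P" by flipping one unit square of the
-- grid at a time, and each flip is a composite of a few square moves of
-- G × H.  So the two walks commute up to square moves already in G × H, and
-- μ carries square moves to the relation ∼ of K.

open import Defs
open import Data.Bool.Properties using (T-∧; T-irrelevant)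
open import Data.Nat using (ℕ; zero; suc)
open import Data.Product using (_,_)
open import Function.Bundles using (Equivalence)
open import Relation.Binary.PropositionalEquality
  using (_≡_; refl; sym; trans; cong; subst; subst₂)

module _ {G : Graph} where

  ++-assoc : ∀ {a b c d} (A : Walk G a b) (B : Walk G b c) (C : Walk G c d) →
             (A ++ B) ++ C ≡ A ++ (B ++ C)
  ++-assoc []           B C = refl
  ++-assoc (step v e A) B C = cong (step v e) (++-assoc A B C)

  ++-identityʳ : ∀ {a b} (A : Walk G a b) → A ++ [] ≡ A
  ++-identityʳ []           = refl
  ++-identityʳ (step v e A) = cong (step v e) (++-identityʳ A)

mapWalk-++ : ∀ {G K} (μ : Hom G K) {a b c} (A : Walk G a b) (B : Walk G b c) →
             mapWalk μ (A ++ B) ≡ mapWalk μ A ++ mapWalk μ B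
mapWalk-++ μ []           B = refl
mapWalk-++ μ (step v e A) B = cong (step _ _) (mapWalk-++ μ A B)

-- This is the part of ∼ that does not involve reduction, and
-- unlike ∼ it is preserved by homomorphisms.

module _ {G : Graph} where

  data _≈_ : ∀ {u v} → Walk G u v → Walk G u v → Set where
    ≈-refl  : ∀ {u v} {W : Walk G u v} → W ≈ W
    ≈-sym   : ∀ {u v} {W W' : Walk G u v} → W ≈ W' → W' ≈ W
    ≈-trans : ∀ {u v} {W₁ W₂ W₃ : Walk G u v} → W₁ ≈ W₂ → W₂ ≈ W₃ → W₁ ≈ W₃
    reroute : ∀ {a b v₁ v₂ v₃ v₄}
              (W : Walk G a v₁) (W' : Walk G v₃ b)
              (e₁₂ : Edge G v₁ v₂) (e₂₃ : Edge G v₂ v₃)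
              (e₁₄ : Edge G v₁ v₄) (e₄₃ : Edge G v₄ v₃) →
              W ++ step v₂ e₁₂ (step v₃ e₂₃ W') ≈ W ++ step v₄ e₁₄ (step v₃ e₄₃ W')

  infix 4 _≈_

  ≈-step : ∀ {u w} (x : V G) (e : Edge G u x) {W₁ W₂ : Walk G x w} →
           W₁ ≈ W₂ → step x e W₁ ≈ step x e W₂
  ≈-step x e ≈-refl                = ≈-refl
  ≈-step x e (≈-sym r)             = ≈-sym (≈-step x e r)
  ≈-step x e (≈-trans r s)         = ≈-trans (≈-step x e r) (≈-step x e s)
  ≈-step x e (reroute W W' _ _ _ _) = reroute (step x e W) W' _ _ _ _

  ≈-++ʳ : ∀ {u v w} {W₁ W₂ : Walk G u v} (B : Walk G v w) →
          W₁ ≈ W₂ → W₁ ++ B ≈ W₂ ++ B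
  ≈-++ʳ B ≈-refl        = ≈-refl
  ≈-++ʳ B (≈-sym r)     = ≈-sym (≈-++ʳ B r)
  ≈-++ʳ B (≈-trans r s) = ≈-trans (≈-++ʳ B r) (≈-++ʳ B s)
  ≈-++ʳ B (reroute {v₂ = v₂} {v₃} {v₄} W W' e₁₂ e₂₃ e₁₄ e₄₃)
    rewrite ++-assoc W (step v₂ e₁₂ (step v₃ e₂₃ W')) B
          | ++-assoc W (step v₄ e₁₄ (step v₃ e₄₃ W')) B
    = reroute W (W' ++ B) e₁₂ e₂₃ e₁₄ e₄₃

-- a single reroute is an instance of the square axiom of ∼ (the square
-- v₁v₂v₃v₄ traversed backwards along v₃v₄v₁ gives back e₁₄, e₄₃ up to the
-- irrelevance of edge proofs)
∼-reroute : ∀ {K : Graph} {a b v₁ v₂ v₃ v₄}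
            (W : Walk K a v₁) (W' : Walk K v₃ b)
            (e₁₂ : Edge K v₁ v₂) (e₂₃ : Edge K v₂ v₃)
            (e₁₄ : Edge K v₁ v₄) (e₄₃ : Edge K v₄ v₃) →
            W ++ step v₂ e₁₂ (step v₃ e₂₃ W') ∼ W ++ step v₄ e₁₄ (step v₃ e₄₃ W')
∼-reroute {K} {v₂ = v₂} {v₃} {v₄} W W' e₁₂ e₂₃ e₁₄ e₄₃ =
  subst₂ (λ f f' → W ++ step v₂ e₁₂ (step v₃ e₂₃ W') ∼ W ++ step v₄ f (step v₃ f' W'))
    (T-irrelevant _ _) (T-irrelevant _ _)
    (∼-sq W W' e₁₂ e₂₃ (flip {G = K} e₄₃) (flip {G = K} e₁₄))

map-≈ : ∀ {G K} (μ : Hom G K) {u v} {W₁ W₂ : Walk G u v} →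
        W₁ ≈ W₂ → mapWalk μ W₁ ∼ mapWalk μ W₂
map-≈ μ ≈-refl        = ∼-refl
map-≈ μ (≈-sym r)     = ∼-sym (map-≈ μ r)
map-≈ μ (≈-trans r s) = ∼-trans (map-≈ μ r) (map-≈ μ s)
map-≈ μ (reroute {v₂ = v₂} {v₃} {v₄} W W' e₁₂ e₂₃ e₁₄ e₄₃)
  rewrite mapWalk-++ μ W (step v₂ e₁₂ (step v₃ e₂₃ W'))
        | mapWalk-++ μ W (step v₄ e₁₄ (step v₃ e₄₃ W'))
  = ∼-reroute (mapWalk μ W) (mapWalk μ W') _ _ _ _

module Product (G H : Graph) where

  _⊗ₑ_ : ∀ {a b x y} → Edge G a b → Edge H x y → Edge (G ⊗ H) (a , x) (b , y)
  e ⊗ₑ f = Equivalence.from T-∧ (e , f)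

  flipG : ∀ {a b} → Edge G a b → Edge G b a
  flipG = flip {G = G}

  flipH : ∀ {a b} → Edge H a b → Edge H b a
  flipH = flip {G = H}

  alongG : ∀ {a b x x'} (P : Walk G a b) (e : Edge H x x') (k : ℕ) →
           length P ≡ length (bounce H e k) → Walk (G ⊗ H) (a , x) (b , x)
  alongG P e k = zipWalk P (bounce H e k)

  alongH : ∀ {a a' x w} (e : Edge G a a') (Q : Walk H x w) (m : ℕ) →
           length (bounce G e m) ≡ length Q → Walk (G ⊗ H) (a , x) (a , w)
  alongH e Q m = zipWalk (bounce G e m) Q

  -- which neighbour of a the walk alongH bounces to is irrelevant: each
  -- odd-position vertex can be rerouted
  alongH-bounce : ∀ {a a₁ a₂ x w} (e : Edge G a a₁) (e' : Edge G a a₂)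
                  (Q : Walk H x w) m q q' → alongH e Q m q ≈ alongH e' Q m q'
  alongH-bounce e e' []                         zero    q  q' = ≈-refl
  alongH-bounce e e' (step _ _ _)               zero    () q'
  alongH-bounce e e' []                         (suc m) () q'
  alongH-bounce e e' (step _ _ [])              (suc m) () q'
  alongH-bounce e e' (step _ _ (step _ _ Q'))   (suc m) q  q' =
    ≈-trans (≈-step _ _ (≈-step _ _ (alongH-bounce e e' Q' m _ _)))
            (reroute [] (alongH e' Q' m _) _ _ _ _)

  alongG-bounce : ∀ {a b x x₁ x₂} (P : Walk G a b) (e : Edge H x x₁)
                  (e' : Edge H x x₂) k p p' → alongG P e k p ≈ alongG P e' k p'
  alongG-bounce []                         e e' zero    p  p' = ≈-refl
  alongG-bounce (step _ _ _)               e e' zero    () p'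
  alongG-bounce []                         e e' (suc k) () p'
  alongG-bounce (step _ _ [])              e e' (suc k) () p'
  alongG-bounce (step _ _ (step _ _ P'))   e e' (suc k) p  p' =
    ≈-trans (≈-step _ _ (≈-step _ _ (alongG-bounce P' e e' k _ _)))
            (reroute [] (alongG P' e' k _) _ _ _ _)

  -- flipping one unit square of the grid: for a u c in G and x y z in H,
  --   (a,x) (u,x') (c,x) (c',y) (c,z)  and  (a,x) (a',y) (a,z) (u,z') (c,z)
  -- are both square-equivalent to  (a,x) (u,y) (a,z) (u,y) (c,z).
  corner : ∀ {a u c a' c' : V G} {x y z x' z' : V H}
           (e₁ : Edge G a u) (e₂ : Edge G u c) (f₁ : Edge H x y) (f₂ : Edge H y z)
           (ex : Edge H x x') (ec : Edge G c c') (ea : Edge G a a') (ez : Edge H z z')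
           p q q' p' →
           alongG (step u e₁ (step c e₂ [])) ex 1 p ++ alongH ec (step y f₁ (step z f₂ [])) 1 q
             ≈ alongH ea (step y f₁ (step z f₂ [])) 1 q' ++ alongG (step u e₁ (step c e₂ [])) ez 1 p'
  corner {a} {u} {c} {x = x} {y} {z} e₁ e₂ f₁ f₂ ex ec ea ez refl refl refl refl =
    ≈-trans fromLeft (≈-sym fromRight)
    where
    Two : Walk G a c
    Two = step u e₁ (step c e₂ [])
    Two' : Walk H x z
    Two' = step y f₁ (step z f₂ [])
    viaUY : Walk (G ⊗ H) (a , x) (c , z)
    viaUY = step (u , y) (e₁ ⊗ₑ f₁) (step (a , z) (flipG e₁ ⊗ₑ f₂)
              (step (u , y) (e₁ ⊗ₑ flipH f₂) (step (c , z) (e₂ ⊗ₑ f₂) [])))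
    -- reroute positions 1 and 3 through (u,y), then position 2 through (a,z)
    fromLeft : alongG Two ex 1 refl ++ alongH ec Two' 1 refl ≈ viaUY
    fromLeft =
      ≈-trans (reroute [] _ _ _ (e₁ ⊗ₑ f₁) (e₂ ⊗ₑ flipH f₁))
      (≈-trans (reroute (step (u , y) (e₁ ⊗ₑ f₁) (step (c , x) (e₂ ⊗ₑ flipH f₁) [])) [] _ _
                        (flipG e₂ ⊗ₑ f₁) (e₂ ⊗ₑ f₂))
               (reroute (step (u , y) (e₁ ⊗ₑ f₁) []) (step (c , z) (e₂ ⊗ₑ f₂) []) _ _
                        (flipG e₁ ⊗ₑ f₂) (e₁ ⊗ₑ flipH f₂)))
    -- reroute positions 1 and 3 through (u,y)
    fromRight : alongH ea Two' 1 refl ++ alongG Two ez 1 refl ≈ viaUY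
    fromRight =
      ≈-trans (reroute [] _ _ _ (e₁ ⊗ₑ f₁) (flipG e₁ ⊗ₑ f₂))
              (reroute (step (u , y) (e₁ ⊗ₑ f₁) (step (a , z) (flipG e₁ ⊗ₑ f₂) [])) [] _ _
                       (e₁ ⊗ₑ flipH f₂) (e₂ ⊗ₑ f₂))

  column : ∀ {a u c a' c' : V G} {x x' w w' : V H}
           (e₁ : Edge G a u) (e₂ : Edge G u c)
           (ex : Edge H x x') (ec : Edge G c c') (ea : Edge G a a') (ew : Edge H w w')
           (Q : Walk H x w) m p q q' p' →
           alongG (step u e₁ (step c e₂ [])) ex 1 p ++ alongH ec Q m q
             ≈ alongH ea Q m q' ++ alongG (step u e₁ (step c e₂ [])) ew 1 p'
  column e₁ e₂ ex ec ea ew [] zero p q q' p' =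
    alongG-bounce (step _ e₁ (step _ e₂ [])) ex ew 1 p p'
  column e₁ e₂ ex ec ea ew (step _ _ _)  zero    p () q' p'
  column e₁ e₂ ex ec ea ew []            (suc m) p () q' p'
  column e₁ e₂ ex ec ea ew (step _ _ []) (suc m) p () q' p'
  column e₁ e₂ ex ec ea ew (step y f₁ (step z f₂ Q')) (suc m) p q q' p' =
    ≈-trans (≈-++ʳ (alongH ec Q' m _) (corner e₁ e₂ f₁ f₂ ex ec ea (flipH f₂) refl refl refl refl))
            (≈-step _ _ (≈-step _ _ (column e₁ e₂ (flipH f₂) ec ea ew Q' m refl _ _ p')))

  grid : ∀ {a b a' b' : V G} {x x' w w' : V H}
         (P : Walk G a b) k (ex : Edge H x x') p (Q : Walk H x w) m (eb : Edge G b b') q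
         (ea : Edge G a a') (ew : Edge H w w') q' p' →
         alongG P ex k p ++ alongH eb Q m q ≈ alongH ea Q m q' ++ alongG P ew k p'
  grid [] zero ex p Q m eb q ea ew q' p' =
    subst (alongH eb Q m q ≈_) (sym (++-identityʳ _)) (alongH-bounce eb ea Q m q q')
  grid (step _ _ _)  zero    ex () Q m eb q ea ew q' p'
  grid []            (suc k) ex () Q m eb q ea ew q' p'
  grid (step _ _ []) (suc k) ex () Q m eb q ea ew q' p'
  -- peel off the first two steps u c of P: first the grid for the rest of P
  -- (past a walk along Q now bouncing at c), then the column for u c
  grid {a} {b} {x = x} {w = w} (step u e₁ (step c e₂ P')) (suc k) ex p Q m eb q ea ew q' p' =
    ≈-trans (≈-step _ _ (≈-step _ _ (grid P' k ex _ Q m eb q (flipG e₂) ew q'' _)))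
            (subst (first ++ rest ≈_) (++-assoc (alongH ea Q m q') twoStep rest)
                   (≈-++ʳ rest (column e₁ e₂ ex (flipG e₂) ea ew Q m refl q'' q' refl)))
    where
    -- the bouncing edge of alongH changes, its length does not
    q'' : length (bounce G (flipG e₂) m) ≡ length Q
    q'' = trans (length-bounce G (flipG e₂) m) (trans (sym (length-bounce G eb m)) q)
    twoStep : Walk (G ⊗ H) (a , w) (c , w)
    twoStep = alongG (step u e₁ (step c e₂ [])) ew 1 refl
    first : Walk (G ⊗ H) (a , x) (c , w)
    first = alongG (step u e₁ (step c e₂ [])) ex 1 refl ++ alongH (flipG e₂) Q m q''
    rest : Walk (G ⊗ H) (c , w) (b , w)
    rest = alongG P' ew k _

corollary5 : (G H K : Graph) (μ : Hom (G ⊗ H) K)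
    {g₀ g₁ : V G} {h₀ h₁ : V H}
    (eg : Edge G g₀ g₁) (eh : Edge H h₀ h₁)
    (C : Walk G g₀ g₀) (D : Walk H h₀ h₀) →
    Reduced C → Reduced D →
    (mapWalk μ (walk×edge G H C eh) ++ mapWalk μ (edge×walk G H eg D)) ∼
    (mapWalk μ (edge×walk G H eg D) ++ mapWalk μ (walk×edge G H C eh))
-- both sides are images of concatenations in G × H; the grid lemma with
-- P = C C and Q = D D relates these by square moves, and μ preserves them
corollary5 G H K μ eg eh C D _ _
  rewrite sym (mapWalk-++ μ (walk×edge G H C eh) (edge×walk G H eg D))
        | sym (mapWalk-++ μ (edge×walk G H eg D) (walk×edge G H C eh))
  = map-≈ μ (Product.grid G H (C ++ C) (length C) eh _ (D ++ D) (length D) eg _ eg eh _ _)
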